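{- Let $\mu\subseteq\nu\subseteq\lambda$ be partitions, $T_1$ a standard Young tableau of shape $\nu/\mu$ and $T_2$ a standard Young tableau of shape $\lambda/\nu$. Then ${\rm sign}(T_1\diamond T_2)={\rm sign}(T_1){\rm sign}(T_2)$.
   Context: Partitions are identified with Young diagrams (cell $(i,j)$: row $i$, column $j$); $\lambda/\mu$ is the set of cells of $\lambda$ not in $\mu$. A standard Young tableau (SYT) of shape $\lambda/\mu$ with $n$ cells is a bijection from its cells to $[n]$ increasing along rows and down columns. Write $(i,j)\lhd(i',j')$ if $i<i'$ or ($i=i'$, $j<j'$). For an SYT $S$ of straight shape, ${\rm sign}(S)=(-1)^{\#\{(a,b):a\lhd b,\,S(a)>S(b)\}}$. For $T_1$ of shape $\nu/\mu$ with $k$ cells and $T_2$ of shape $\lambda/\nu$, $T_1\diamond T_2$ is the SYT of shape $\lambda/\mu$ equal to $T_1$ on $\nu/\mu$ and $T_2+k$ on $\lambda/\nu$. For an SYT $T$ of shape $\lambda/\mu$, ${\rm sign}(T)={\rm sign}(T_0){\rm sign}(T_0\diamond T)$ for any SYT $T_0$ of shape $\mu$ (this does not depend on $T_0$). -}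

module Defs where

open import Data.Nat using (ℕ; zero; suc; _+_; _∸_; _≤_; _<_; _<?_; _≟_)
open import Data.Nat.Properties using (_≤?_)
open import Data.Integer as ℤ using (ℤ; +_; -_)
open import Data.List using (List; []; _∷_; length; sum; filter; concatMap; map; upTo)
open import Data.List.Relation.Unary.All using (All)
open import Data.List.Relation.Unary.Linked using (Linked)
open import Data.Product using (_×_; _,_; Σ; ∃)
open import Data.Sum using (_⊎_)
open import Relation.Nullary using (Dec; yes; no; ¬_)
open import Relation.Nullary.Decidable using (_×-dec_; _⊎-dec_)
open import Relation.Binary.PropositionalEquality using (_≡_)

record Partition : Set where
  constructor mkPartition
  field
    parts      : List ℕ
    positive   : All (λ x → 0 < x) parts
    decreasing : Linked (λ a b → b ≤ a) parts
open Partition public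

-- the i-th part (rows indexed from 0), 0 beyond the length
part : Partition → ℕ → ℕ
part p i = go (parts p) i
  where
  go : List ℕ → ℕ → ℕ
  go []       _       = 0
  go (x ∷ _)  zero    = x
  go (_ ∷ xs) (suc i) = go xs i

_⊆ₚ_ : Partition → Partition → Set
μ ⊆ₚ λ′ = ∀ i → part μ i ≤ part λ′ i

emptyPartition : Partition
emptyPartition = mkPartition [] All.[] Linked.[]

-- cells are (row , column), 0-indexed
Cell : Set
Cell = ℕ × ℕ

InSkew : Partition → Partition → Cell → Set
InSkew λ′ μ (i , j) = (part μ i ≤ j) × (j < part λ′ i)

skewCells : Partition → Partition → List Cell
skewCells λ′ μ =
  concatMap (λ i → map (λ j → (i , j)) (filter (λ j → part μ i ≤? j) (upTo (part λ′ i))))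
            (upTo (length (parts λ′)))

skewSize : Partition → Partition → ℕ
skewSize λ′ μ = length (skewCells λ′ μ)

-- A filling of cells by positive integers (only the values on cells of the shape matter)
Filling : Set
Filling = Cell → ℕ

record IsSYT (λ′ μ : Partition) (T : Filling) : Set where
  field
    inRange    : ∀ c → InSkew λ′ μ c → (1 ≤ T c) × (T c ≤ skewSize λ′ μ)
    injective  : ∀ c d → InSkew λ′ μ c → InSkew λ′ μ d → T c ≡ T d → c ≡ d
    surjective : ∀ k → 1 ≤ k → k ≤ skewSize λ′ μ → Σ Cell (λ c → InSkew λ′ μ c × T c ≡ k)
    rowInc     : ∀ i j → InSkew λ′ μ (i , j) → InSkew λ′ μ (i , suc j) →
                 T (i , j) < T (i , suc j)
    colInc     : ∀ i j → InSkew λ′ μ (i , j) → InSkew λ′ μ (suc i , j) →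
                 T (i , j) < T (suc i , j)

_◁_ : Cell → Cell → Set
(i , j) ◁ (i′ , j′) = (i < i′) ⊎ ((i ≡ i′) × (j < j′))

_◁?_ : (a b : Cell) → Dec (a ◁ b)
(i , j) ◁? (i′ , j′) = (i <? i′) ⊎-dec ((i ≟ i′) ×-dec (j <? j′))

inversions : Partition → Filling → ℕ
inversions λ′ S =
  length (filter (λ ab → (Data.Product.proj₁ ab ◁? Data.Product.proj₂ ab)
                          ×-dec (S (Data.Product.proj₂ ab) <? S (Data.Product.proj₁ ab)))
                 (concatMap (λ a → map (λ b → (a , b)) cs) cs))
  where cs = skewCells λ′ emptyPartition

minusOnePow : ℕ → ℤ
minusOnePow zero    = + 1
minusOnePow (suc k) = - minusOnePow k

signStraight : Partition → Filling → ℤ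
signStraight λ′ S = minusOnePow (inversions λ′ S)

diamond : (μ ν : Partition) → Filling → Filling → Filling
diamond μ ν T₁ T₂ (i , j) with j <? part ν i
... | yes _ = T₁ (i , j)
... | no  _ = T₂ (i , j) + skewSize ν μ

-- sign(T) for T of shape λ/μ, computed with the auxiliary SYT T₀ of shape μ:
-- sign(T₀) · sign(T₀ ⋄ T)
skewSignVia : (λ′ μ : Partition) → (T₀ T : Filling) → ℤ
skewSignVia λ′ μ T₀ T =
  signStraight μ T₀ ℤ.* signStraight λ′ (diamond emptyPartition μ T₀ T)

module Submission where

-- Key fact (inversions-diamond): if S fills the straight shape ν with values
-- ≤ |ν| and T fills λ/ν with positive values, then
--     inv_λ(S ⋄ T) = inv_ν(S) + cross_{λ,ν}(T),
-- where cross_{λ,ν}(T) depends on T only.  Indeed every entry of S ⋄ T on ν is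
-- smaller than every entry on λ/ν, so a pair (a , b) with a ◁ b contributes
-- an inversion of S if both cells lie in ν, always contributes if only b lies
-- in ν, never if only a lies in ν, and contributes an inversion of T if
-- neither lies in ν.  Hence sign(S ⋄ T) = sign(S) · (-1)^cross(T).
--
-- The theorem follows: T₀ ⋄ (T₁ ⋄ T₂) = (T₀ ⋄ T₁) ⋄ T₂ (diamond-assoc), so both
-- sides of the identity contain the factor (-1)^cross(T₂), and the auxiliary
-- tableau T₀′ of shape ν contributes sign(T₀′)² = 1.
--
-- To compare inversion counts over different shapes, all counts are rewritten
-- as double sums over rows and columns (cellSum) with indicator weights.

open import Defs
open import Data.Integer using (_*_)
open import Relation.Binary.PropositionalEquality using (_≡_)

open import Data.Nat using (ℕ; zero; suc; _+_; _∸_; _≤_; _<_; _<?_; z≤n; s≤s)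
import Data.Nat.Properties as ℕₚ
open ℕₚ using (_≤?_)
open import Data.Integer as ℤ using (ℤ; -_)
import Data.Integer.Properties as ℤₚ
open import Data.List using (List; []; _∷_; length; filter; concatMap; map; upTo; applyUpTo; _++_)
open import Data.List.Relation.Unary.All as All using ()
open import Data.List.Relation.Unary.Linked as Linked using ()
open import Data.Product using (_×_; _,_; proj₁; proj₂)
open import Data.Bool using (true; false; if_then_else_)
open import Relation.Nullary using (Dec; yes; no; ¬_; does)
open import Relation.Nullary.Decidable using (_×-dec_)
open import Relation.Binary.PropositionalEquality using (refl; sym; trans; cong; cong₂; module ≡-Reasoning)
open import Data.Empty using (⊥-elim)
open import Function using (_∘_)
open import Algebra.Properties.CommutativeSemigroup ℕₚ.+-commutativeSemigroup using (interchange)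

sumOver : {A : Set} → (A → ℕ) → List A → ℕ
sumOver f []       = 0
sumOver f (x ∷ xs) = f x + sumOver f xs

sumTo : (ℕ → ℕ) → ℕ → ℕ
sumTo f zero    = 0
sumTo f (suc n) = f 0 + sumTo (f ∘ suc) n

select : {P : Set} → Dec P → ℕ → ℕ → ℕ
select d x y = if does d then x else y

guard : {P : Set} → Dec P → ℕ → ℕ
guard d x = select d x 0

select-yes : {P : Set} (d : Dec P) {x y : ℕ} → P → select d x y ≡ x
select-yes (yes _) p = refl
select-yes (no ¬p) p = ⊥-elim (¬p p)

select-no : {P : Set} (d : Dec P) {x y : ℕ} → ¬ P → select d x y ≡ y
select-no (yes p) ¬p = ⊥-elim (¬p p)
select-no (no _)  ¬p = refl

guard-iff : {P Q : Set} {x : ℕ} → (P → Q) → (Q → P) → (d : Dec P) (e : Dec Q) → guard d x ≡ guard e x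
guard-iff f g (yes p) (yes q) = refl
guard-iff f g (yes p) (no ¬q) = ⊥-elim (¬q (f p))
guard-iff f g (no ¬p) (yes q) = ⊥-elim (¬p (g q))
guard-iff f g (no ¬p) (no ¬q) = refl

guard-complement : ∀ m j → 1 ≡ guard (m ≤? j) 1 + guard (j <? m) 1
guard-complement m j with j <? m
... | yes j<m = sym (cong₂ _+_ (select-no (m ≤? j) (ℕₚ.<⇒≱ j<m)) (select-yes (j <? m) j<m))
... | no  j≮m = sym (cong₂ _+_ (select-yes (m ≤? j) (ℕₚ.≮⇒≥ j≮m)) (select-no (j <? m) j≮m))

sumOver-cong : {A : Set} {f g : A → ℕ} (xs : List A) → (∀ x → f x ≡ g x) → sumOver f xs ≡ sumOver g xs
sumOver-cong []       e = refl
sumOver-cong (x ∷ xs) e = cong₂ _+_ (e x) (sumOver-cong xs e)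

sumOver-++ : {A : Set} (f : A → ℕ) (xs ys : List A) → sumOver f (xs ++ ys) ≡ sumOver f xs + sumOver f ys
sumOver-++ f []       ys = refl
sumOver-++ f (x ∷ xs) ys = trans (cong (f x +_) (sumOver-++ f xs ys)) (sym (ℕₚ.+-assoc (f x) _ _))

sumOver-concatMap : {A B : Set} (f : B → ℕ) (g : A → List B) (xs : List A) →
  sumOver f (concatMap g xs) ≡ sumOver (λ x → sumOver f (g x)) xs
sumOver-concatMap f g []       = refl
sumOver-concatMap f g (x ∷ xs) =
  trans (sumOver-++ f (g x) (concatMap g xs)) (cong (sumOver f (g x) +_) (sumOver-concatMap f g xs))

sumOver-map : {A B : Set} (f : B → ℕ) (g : A → B) (xs : List A) → sumOver f (map g xs) ≡ sumOver (f ∘ g) xs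
sumOver-map f g []       = refl
sumOver-map f g (x ∷ xs) = cong (f (g x) +_) (sumOver-map f g xs)

sumOver-filter : {A : Set} {P : A → Set} (P? : ∀ x → Dec (P x)) (f : A → ℕ) (xs : List A) →
  sumOver f (filter P? xs) ≡ sumOver (λ x → guard (P? x) (f x)) xs
sumOver-filter P? f []       = refl
sumOver-filter P? f (x ∷ xs) with does (P? x)
... | true  = cong (f x +_) (sumOver-filter P? f xs)
... | false = sumOver-filter P? f xs

sumOver-applyUpTo : (f g : ℕ → ℕ) (n : ℕ) → sumOver f (applyUpTo g n) ≡ sumTo (f ∘ g) n
sumOver-applyUpTo f g zero    = refl
sumOver-applyUpTo f g (suc n) = cong (f (g 0) +_) (sumOver-applyUpTo f (g ∘ suc) n)

length-sumOver : {A : Set} (xs : List A) → length xs ≡ sumOver (λ _ → 1) xs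
length-sumOver []       = refl
length-sumOver (x ∷ xs) = cong suc (length-sumOver xs)

sumTo-cong : {f g : ℕ → ℕ} (n : ℕ) → (∀ k → k < n → f k ≡ g k) → sumTo f n ≡ sumTo g n
sumTo-cong zero    e = refl
sumTo-cong (suc n) e = cong₂ _+_ (e 0 (s≤s z≤n)) (sumTo-cong n (λ k k<n → e (suc k) (s≤s k<n)))

sumTo-zero : {f : ℕ → ℕ} (n : ℕ) → (∀ k → k < n → f k ≡ 0) → sumTo f n ≡ 0
sumTo-zero zero    e = refl
sumTo-zero (suc n) e = cong₂ _+_ (e 0 (s≤s z≤n)) (sumTo-zero n (λ k k<n → e (suc k) (s≤s k<n)))

sumTo-+ : (f g : ℕ → ℕ) (n : ℕ) → sumTo (λ k → f k + g k) n ≡ sumTo f n + sumTo g n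
sumTo-+ f g zero    = refl
sumTo-+ f g (suc n) =
  trans (cong (f 0 + g 0 +_) (sumTo-+ (f ∘ suc) (g ∘ suc) n)) (interchange (f 0) (g 0) _ _)

sumTo-split : (f : ℕ → ℕ) (n m : ℕ) → sumTo f (n + m) ≡ sumTo f n + sumTo (λ k → f (n + k)) m
sumTo-split f zero    m = refl
sumTo-split f (suc n) m = trans (cong (f 0 +_) (sumTo-split (f ∘ suc) n m)) (sym (ℕₚ.+-assoc (f 0) _ _))

sumTo-guard : {P : Set} (d : Dec P) (f : ℕ → ℕ) (n : ℕ) → sumTo (λ k → guard d (f k)) n ≡ guard d (sumTo f n)
sumTo-guard d f n with does d
... | true  = refl
... | false = sumTo-zero n (λ _ _ → refl)

part-beyond : ∀ p k → part p (length (parts p) + k) ≡ 0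
part-beyond p = beyond (parts p) (positive p) (decreasing p)
  where
  beyond : ∀ xs a d k → part (mkPartition xs a d) (length xs + k) ≡ 0
  beyond []       _ _ k = refl
  beyond (x ∷ xs) a d k = beyond xs (All.tail a) (Linked.tail d) k

inShape? : (p : Partition) (c : Cell) → Dec (proj₂ c < part p (proj₁ c))
inShape? p c = proj₂ c <? part p (proj₁ c)

-- Σ_{i < N} Σ_{j < λ_i} w(i , j); any N ≥ ℓ(λ) sums over all cells of λ.
cellSum : Partition → ℕ → (Cell → ℕ) → ℕ
cellSum la N w = sumTo (λ i → sumTo (λ j → w (i , j)) (part la i)) N

cellSum-cong : (la : Partition) (N : ℕ) {f g : Cell → ℕ} →
  (∀ i j → j < part la i → f (i , j) ≡ g (i , j)) → cellSum la N f ≡ cellSum la N g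
cellSum-cong la N e = sumTo-cong N (λ i _ → sumTo-cong (part la i) (λ j j< → e i j j<))

cellSum-+ : (la : Partition) (N : ℕ) (f g : Cell → ℕ) →
  cellSum la N (λ c → f c + g c) ≡ cellSum la N f + cellSum la N g
cellSum-+ la N f g =
  trans (sumTo-cong N (λ i _ → sumTo-+ (λ j → f (i , j)) (λ j → g (i , j)) (part la i))) (sumTo-+ _ _ N)

cellSum-guard : {P : Set} (la : Partition) (N : ℕ) (d : Dec P) (f : Cell → ℕ) →
  cellSum la N (λ c → guard d (f c)) ≡ guard d (cellSum la N f)
cellSum-guard la N d f = trans (sumTo-cong N (λ i _ → sumTo-guard d (λ j → f (i , j)) (part la i))) (sumTo-guard d _ N)

cellSum-restrict : (nu la : Partition) → nu ⊆ₚ la → (N : ℕ) (f : Cell → ℕ) →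
  cellSum la N (λ c → guard (inShape? nu c) (f c)) ≡ cellSum nu N f
cellSum-restrict nu la nu⊆la N f = sumTo-cong N (λ i _ → row i)
  where
  row : ∀ i → sumTo (λ j → guard (j <? part nu i) (f (i , j))) (part la i) ≡ sumTo (λ j → f (i , j)) (part nu i)
  row i = begin
      sumTo g (part la i)
        ≡⟨ cong (sumTo g) (sym (ℕₚ.m+[n∸m]≡n (nu⊆la i))) ⟩
      sumTo g (part nu i + (part la i ∸ part nu i))
        ≡⟨ sumTo-split g (part nu i) _ ⟩
      sumTo g (part nu i) + sumTo (λ k → g (part nu i + k)) (part la i ∸ part nu i)
        ≡⟨ cong₂ _+_ (sumTo-cong (part nu i) inside) (sumTo-zero _ outside) ⟩
      sumTo (λ j → f (i , j)) (part nu i) + 0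
        ≡⟨ ℕₚ.+-identityʳ _ ⟩
      sumTo (λ j → f (i , j)) (part nu i) ∎
    where
    open ≡-Reasoning
    g : ℕ → ℕ
    g j = guard (j <? part nu i) (f (i , j))
    inside : ∀ k → k < part nu i → g k ≡ f (i , k)
    inside k k< = select-yes (k <? part nu i) k<
    outside : ∀ k → k < part la i ∸ part nu i → g (part nu i + k) ≡ 0
    outside k _ = select-no (part nu i + k <? part nu i) (ℕₚ.m+n≮m (part nu i) k)

sumOver-skewCells : (la mu : Partition) (w : Cell → ℕ) (k : ℕ) →
  sumOver w (skewCells la mu)
    ≡ cellSum la (length (parts la) + k) (λ c → guard (part mu (proj₁ c) ≤? proj₂ c) (w c))
sumOver-skewCells la mu w k = begin
    sumOver w (skewCells la mu)
      ≡⟨ sumOver-concatMap w row (upTo L) ⟩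
    sumOver (λ i → sumOver w (row i)) (upTo L)
      ≡⟨ sumOver-cong (upTo L) rowSum ⟩
    sumOver h (upTo L)
      ≡⟨ sumOver-applyUpTo h (λ i → i) L ⟩
    sumTo h L
      ≡⟨ sym (ℕₚ.+-identityʳ _) ⟩
    sumTo h L + 0
      ≡⟨ cong (sumTo h L +_) (sym (sumTo-zero k (λ t _ → cong (sumTo _) (part-beyond la t)))) ⟩
    sumTo h L + sumTo (λ t → h (L + t)) k
      ≡⟨ sym (sumTo-split h L k) ⟩
    sumTo h (L + k) ∎
  where
  open ≡-Reasoning
  L : ℕ
  L = length (parts la)
  row : ℕ → List Cell
  row i = map (λ j → (i , j)) (filter (λ j → part mu i ≤? j) (upTo (part la i)))
  h : ℕ → ℕ
  h i = sumTo (λ j → guard (part mu i ≤? j) (w (i , j))) (part la i)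
  rowSum : ∀ i → sumOver w (row i) ≡ h i
  rowSum i = trans (sumOver-map w (λ j → (i , j)) (filter (λ j → part mu i ≤? j) (upTo (part la i))))
            (trans (sumOver-filter (λ j → part mu i ≤? j) (λ j → w (i , j)) (upTo (part la i)))
                   (sumOver-applyUpTo _ (λ j → j) (part la i)))

sumOver-cells : (la : Partition) (w : Cell → ℕ) (k : ℕ) →
  sumOver w (skewCells la emptyPartition) ≡ cellSum la (length (parts la) + k) w
sumOver-cells la w k = sumOver-skewCells la emptyPartition w k

skewSize-split : (mu nu : Partition) → mu ⊆ₚ nu →
  skewSize nu emptyPartition ≡ skewSize nu mu + skewSize mu emptyPartition
skewSize-split mu nu mu⊆nu = begin
    skewSize nu emptyPartition
      ≡⟨ count nu Lμ ⟩
    cellSum nu N one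
      ≡⟨ cellSum-cong nu N (λ i j _ → guard-complement (part mu i) j) ⟩
    cellSum nu N (λ c → guard (part mu (proj₁ c) ≤? proj₂ c) 1 + guard (inShape? mu c) 1)
      ≡⟨ cellSum-+ nu N _ _ ⟩
    cellSum nu N (λ c → guard (part mu (proj₁ c) ≤? proj₂ c) 1) + cellSum nu N (λ c → guard (inShape? mu c) 1)
      ≡⟨ cong₂ _+_ (sym (trans (length-sumOver (skewCells nu mu)) (sumOver-skewCells nu mu one Lμ)))
                   (cellSum-restrict mu nu mu⊆nu N one) ⟩
    skewSize nu mu + cellSum mu N one
      ≡⟨ cong (λ M → skewSize nu mu + cellSum mu M one) (ℕₚ.+-comm Lν Lμ) ⟩
    skewSize nu mu + cellSum mu (Lμ + Lν) one
      ≡⟨ cong (skewSize nu mu +_) (sym (count mu Lν)) ⟩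
    skewSize nu mu + skewSize mu emptyPartition ∎
  where
  open ≡-Reasoning
  Lν : ℕ
  Lν = length (parts nu)
  Lμ : ℕ
  Lμ = length (parts mu)
  N : ℕ
  N = Lν + Lμ
  one : Cell → ℕ
  one _ = 1
  count : ∀ p k → skewSize p emptyPartition ≡ cellSum p (length (parts p) + k) one
  count p k = trans (length-sumOver (skewCells p emptyPartition)) (sumOver-cells p one k)

invPair : Cell → Cell → ℕ → ℕ → ℕ
invPair a b u v = guard ((a ◁? b) ×-dec (v <? u)) 1

invAt : Filling → Cell → Cell → ℕ
invAt F a b = invPair a b (F a) (F b)

invPair-ordered : (a b : Cell) (u v : ℕ) → ¬ (v < u) → invPair a b u v ≡ 0
invPair-ordered a b u v v≮u = select-no ((a ◁? b) ×-dec (v <? u)) (v≮u ∘ proj₂)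

invPair-reversed : (a b : Cell) (u v : ℕ) → v < u → invPair a b u v ≡ guard (a ◁? b) 1
invPair-reversed a b u v v<u = guard-iff proj₁ (λ a◁b → a◁b , v<u) ((a ◁? b) ×-dec (v <? u)) (a ◁? b)

invPair-shift : (a b : Cell) (u v n : ℕ) → invPair a b (u + n) (v + n) ≡ invPair a b u v
invPair-shift a b u v n = guard-iff (λ (a◁b , lt) → a◁b , ℕₚ.+-cancelʳ-< n v u lt)
                                    (λ (a◁b , lt) → a◁b , ℕₚ.+-monoˡ-< n lt)
                                    ((a ◁? b) ×-dec (v + n <? u + n)) ((a ◁? b) ×-dec (v <? u))

inversions-cellSum : (la : Partition) (F : Filling) (k : ℕ) →
  inversions la F ≡ cellSum la (length (parts la) + k) (λ a → cellSum la (length (parts la) + k) (invAt F a))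
inversions-cellSum la F k = begin
    inversions la F
      ≡⟨ length-sumOver (filter Q pairs) ⟩
    sumOver (λ _ → 1) (filter Q pairs)
      ≡⟨ sumOver-filter Q (λ _ → 1) pairs ⟩
    sumOver (λ ab → guard (Q ab) 1) pairs
      ≡⟨ sumOver-concatMap _ (λ a → map (λ b → (a , b)) cs) cs ⟩
    sumOver (λ a → sumOver (λ ab → guard (Q ab) 1) (map (λ b → (a , b)) cs)) cs
      ≡⟨ sumOver-cong cs (λ a → sumOver-map _ (λ b → (a , b)) cs) ⟩
    sumOver (λ a → sumOver (invAt F a) cs) cs
      ≡⟨ sumOver-cells la _ k ⟩
    cellSum la N (λ a → sumOver (invAt F a) cs)
      ≡⟨ cellSum-cong la N (λ i j _ → sumOver-cells la (invAt F (i , j)) k) ⟩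
    cellSum la N (λ a → cellSum la N (invAt F a)) ∎
  where
  open ≡-Reasoning
  cs : List Cell
  cs = skewCells la emptyPartition
  pairs : List (Cell × Cell)
  pairs = concatMap (λ a → map (λ b → (a , b)) cs) cs
  N : ℕ
  N = length (parts la) + k
  Q : (ab : Cell × Cell) → Dec ((proj₁ ab ◁ proj₂ ab) × (F (proj₂ ab) < F (proj₁ ab)))
  Q ab = (proj₁ ab ◁? proj₂ ab) ×-dec (F (proj₂ ab) <? F (proj₁ ab))

inversions-cong : (la : Partition) (F G : Filling) → (∀ c → F c ≡ G c) → inversions la F ≡ inversions la G
inversions-cong la F G F≗G = begin
    inversions la F
      ≡⟨ inversions-cellSum la F 0 ⟩
    cellSum la N (λ a → cellSum la N (invAt F a))
      ≡⟨ cellSum-cong la N (λ i j _ → cellSum-cong la N (λ i′ j′ _ →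
           cong₂ (invPair (i , j) (i′ , j′)) (F≗G (i , j)) (F≗G (i′ , j′)))) ⟩
    cellSum la N (λ a → cellSum la N (invAt G a))
      ≡⟨ sym (inversions-cellSum la G 0) ⟩
    inversions la G ∎
  where
  open ≡-Reasoning
  N : ℕ
  N = length (parts la) + 0

diamond-inner : (mu nu : Partition) (T₁ T₂ : Filling) (i j : ℕ) → j < part nu i →
  diamond mu nu T₁ T₂ (i , j) ≡ T₁ (i , j)
diamond-inner mu nu T₁ T₂ i j p with j <? part nu i
... | yes _ = refl
... | no ¬p = ⊥-elim (¬p p)

diamond-outer : (mu nu : Partition) (T₁ T₂ : Filling) (i j : ℕ) → ¬ (j < part nu i) →
  diamond mu nu T₁ T₂ (i , j) ≡ T₂ (i , j) + skewSize nu mu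
diamond-outer mu nu T₁ T₂ i j ¬p with j <? part nu i
... | yes p = ⊥-elim (¬p p)
... | no _  = refl

diamond-assoc : (mu nu : Partition) → mu ⊆ₚ nu → (T₀ T₁ T₂ : Filling) → ∀ c →
  diamond emptyPartition mu T₀ (diamond mu nu T₁ T₂) c
    ≡ diamond emptyPartition nu (diamond emptyPartition mu T₀ T₁) T₂ c
diamond-assoc mu nu mu⊆nu T₀ T₁ T₂ (i , j) = byPosition (j <? part mu i) (j <? part nu i)
  where
  open ≡-Reasoning
  ∅ : Partition
  ∅ = emptyPartition
  G : Filling
  G = diamond ∅ mu T₀ T₁
  byPosition : Dec (j < part mu i) → Dec (j < part nu i) →
    diamond ∅ mu T₀ (diamond mu nu T₁ T₂) (i , j) ≡ diamond ∅ nu G T₂ (i , j)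
  byPosition (yes j<μ) _ = begin
      diamond ∅ mu T₀ (diamond mu nu T₁ T₂) (i , j) ≡⟨ diamond-inner ∅ mu T₀ _ i j j<μ ⟩
      T₀ (i , j)                                    ≡⟨ diamond-inner ∅ mu T₀ T₁ i j j<μ ⟨
      G (i , j)                                     ≡⟨ diamond-inner ∅ nu G T₂ i j (ℕₚ.<-≤-trans j<μ (mu⊆nu i)) ⟨
      diamond ∅ nu G T₂ (i , j)                     ∎
  byPosition (no j≮μ) (yes j<ν) = begin
      diamond ∅ mu T₀ (diamond mu nu T₁ T₂) (i , j) ≡⟨ diamond-outer ∅ mu T₀ _ i j j≮μ ⟩
      diamond mu nu T₁ T₂ (i , j) + skewSize mu ∅   ≡⟨ cong (_+ skewSize mu ∅) (diamond-inner mu nu T₁ T₂ i j j<ν) ⟩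
      T₁ (i , j) + skewSize mu ∅                    ≡⟨ diamond-outer ∅ mu T₀ T₁ i j j≮μ ⟨
      G (i , j)                                     ≡⟨ diamond-inner ∅ nu G T₂ i j j<ν ⟨
      diamond ∅ nu G T₂ (i , j)                     ∎
  byPosition (no j≮μ) (no j≮ν) = begin
      diamond ∅ mu T₀ (diamond mu nu T₁ T₂) (i , j) ≡⟨ diamond-outer ∅ mu T₀ _ i j j≮μ ⟩
      diamond mu nu T₁ T₂ (i , j) + skewSize mu ∅   ≡⟨ cong (_+ skewSize mu ∅) (diamond-outer mu nu T₁ T₂ i j j≮ν) ⟩
      T₂ (i , j) + skewSize nu mu + skewSize mu ∅   ≡⟨ ℕₚ.+-assoc (T₂ (i , j)) _ _ ⟩
      T₂ (i , j) + (skewSize nu mu + skewSize mu ∅) ≡⟨ cong (T₂ (i , j) +_) (skewSize-split mu nu mu⊆nu) ⟨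
      T₂ (i , j) + skewSize nu ∅                    ≡⟨ diamond-outer ∅ nu G T₂ i j j≮ν ⟨
      diamond ∅ nu G T₂ (i , j)                     ∎

diamond-bounded : (mu nu : Partition) → mu ⊆ₚ nu → (S T : Filling) →
  (∀ i j → j < part mu i → S (i , j) ≤ skewSize mu emptyPartition) →
  (∀ i j → part mu i ≤ j → j < part nu i → T (i , j) ≤ skewSize nu mu) →
  ∀ i j → j < part nu i → diamond emptyPartition mu S T (i , j) ≤ skewSize nu emptyPartition
diamond-bounded mu nu mu⊆nu S T S≤ T≤ i j j<ν = byPosition (j <? part mu i)
  where
  open ℕₚ.≤-Reasoning
  ∅ : Partition
  ∅ = emptyPartition
  byPosition : Dec (j < part mu i) → diamond ∅ mu S T (i , j) ≤ skewSize nu ∅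
  byPosition (yes j<μ) = begin
      diamond ∅ mu S T (i , j)       ≡⟨ diamond-inner ∅ mu S T i j j<μ ⟩
      S (i , j)                      ≤⟨ S≤ i j j<μ ⟩
      skewSize mu ∅                  ≤⟨ ℕₚ.m≤n+m _ (skewSize nu mu) ⟩
      skewSize nu mu + skewSize mu ∅ ≡⟨ skewSize-split mu nu mu⊆nu ⟨
      skewSize nu ∅                  ∎
  byPosition (no j≮μ) = begin
      diamond ∅ mu S T (i , j)       ≡⟨ diamond-outer ∅ mu S T i j j≮μ ⟩
      T (i , j) + skewSize mu ∅      ≤⟨ ℕₚ.+-monoˡ-≤ (skewSize mu ∅) (T≤ i j (ℕₚ.≮⇒≥ j≮μ) j<ν) ⟩
      skewSize nu mu + skewSize mu ∅ ≡⟨ skewSize-split mu nu mu⊆nu ⟨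
      skewSize nu ∅                  ∎

innerInv : Partition → Filling → Cell → Cell → ℕ
innerInv nu S a b = guard (inShape? nu a) (guard (inShape? nu b) (invAt S a b))

-- Contribution of the pair (a , b) with a outside ν: every such pair with b ∈ ν
-- and a ◁ b is an inversion, and pairs with b ∉ ν count inversions of T.
crossInv : Partition → Filling → Cell → Cell → ℕ
crossInv nu T a b = select (inShape? nu a) 0 (select (inShape? nu b) (guard (a ◁? b) 1) (invAt T a b))

crossCount : Partition → Partition → Filling → ℕ
crossCount la nu T = cellSum la N (λ a → cellSum la N (crossInv nu T a))
  where
  N : ℕ
  N = length (parts la) + length (parts nu)

invAt-diamond : (nu la : Partition) (S T : Filling) →
  (∀ i j → j < part nu i → S (i , j) ≤ skewSize nu emptyPartition) →
  (∀ i j → part nu i ≤ j → j < part la i → 1 ≤ T (i , j)) →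
  ∀ i j i′ j′ → j < part la i →
  invAt (diamond emptyPartition nu S T) (i , j) (i′ , j′)
    ≡ innerInv nu S (i , j) (i′ , j′) + crossInv nu T (i , j) (i′ , j′)
invAt-diamond nu la S T S≤ T≥1 i j i′ j′ j<λ = byPosition (inShape? nu a) (inShape? nu b)
  where
  open ≡-Reasoning
  ∅ : Partition
  ∅ = emptyPartition
  a : Cell
  a = (i , j)
  b : Cell
  b = (i′ , j′)
  n : ℕ
  n = skewSize nu ∅
  F : Filling
  F = diamond ∅ nu S T
  a? : Dec (proj₂ a < part nu (proj₁ a))
  a? = inShape? nu a
  b? : Dec (proj₂ b < part nu (proj₁ b))
  b? = inShape? nu b
  byPosition : Dec (j < part nu i) → Dec (j′ < part nu i′) →
    invAt F a b ≡ innerInv nu S a b + crossInv nu T a b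
  byPosition (yes j<ν) (yes j′<ν) = begin
      invAt F a b                           ≡⟨ cong₂ (invPair a b) (diamond-inner ∅ nu S T i j j<ν)
                                                                   (diamond-inner ∅ nu S T i′ j′ j′<ν) ⟩
      invAt S a b                           ≡⟨ ℕₚ.+-identityʳ _ ⟨
      invAt S a b + 0                       ≡⟨ cong₂ _+_ (trans (select-yes a? j<ν) (select-yes b? j′<ν))
                                                         (select-yes a? j<ν) ⟨
      innerInv nu S a b + crossInv nu T a b ∎
  byPosition (yes j<ν) (no j′≮ν) = begin
      invAt F a b                           ≡⟨ cong₂ (invPair a b) (diamond-inner ∅ nu S T i j j<ν)
                                                                   (diamond-outer ∅ nu S T i′ j′ j′≮ν) ⟩
      invPair a b (S a) (T b + n)           ≡⟨ invPair-ordered a b _ _ (ℕₚ.≤⇒≯ S≤T+n) ⟩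
      0 + 0                                 ≡⟨ cong₂ _+_ (trans (select-yes a? j<ν) (select-no b? j′≮ν))
                                                         (select-yes a? j<ν) ⟨
      innerInv nu S a b + crossInv nu T a b ∎
    where
    S≤T+n : S a ≤ T b + n
    S≤T+n = ℕₚ.≤-trans (S≤ i j j<ν) (ℕₚ.m≤n+m n (T b))
  byPosition (no j≮ν) (yes j′<ν) = begin
      invAt F a b                           ≡⟨ cong₂ (invPair a b) (diamond-outer ∅ nu S T i j j≮ν)
                                                                   (diamond-inner ∅ nu S T i′ j′ j′<ν) ⟩
      invPair a b (T a + n) (S b)           ≡⟨ invPair-reversed a b _ _ S<T+n ⟩
      0 + guard (a ◁? b) 1                  ≡⟨ cong₂ _+_ (select-no a? j≮ν)
                                                         (trans (select-no a? j≮ν) (select-yes b? j′<ν)) ⟨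
      innerInv nu S a b + crossInv nu T a b ∎
    where
    S<T+n : S b < T a + n
    S<T+n = ℕₚ.≤-<-trans (S≤ i′ j′ j′<ν) (ℕₚ.+-monoˡ-≤ n (T≥1 i j (ℕₚ.≮⇒≥ j≮ν) j<λ))
  byPosition (no j≮ν) (no j′≮ν) = begin
      invAt F a b                           ≡⟨ cong₂ (invPair a b) (diamond-outer ∅ nu S T i j j≮ν)
                                                                   (diamond-outer ∅ nu S T i′ j′ j′≮ν) ⟩
      invPair a b (T a + n) (T b + n)       ≡⟨ invPair-shift a b (T a) (T b) n ⟩
      0 + invAt T a b                       ≡⟨ cong₂ _+_ (select-no a? j≮ν)
                                                         (trans (select-no a? j≮ν) (select-no b? j′≮ν)) ⟨
      innerInv nu S a b + crossInv nu T a b ∎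

inversions-diamond : (nu la : Partition) → nu ⊆ₚ la → (S T : Filling) →
  (∀ i j → j < part nu i → S (i , j) ≤ skewSize nu emptyPartition) →
  (∀ i j → part nu i ≤ j → j < part la i → 1 ≤ T (i , j)) →
  inversions la (diamond emptyPartition nu S T) ≡ inversions nu S + crossCount la nu T
inversions-diamond nu la nu⊆la S T S≤ T≥1 = begin
    inversions la (diamond emptyPartition nu S T)
      ≡⟨ inversions-cellSum la _ Lν ⟩
    cellSum la N (λ a → cellSum la N (invAt (diamond emptyPartition nu S T) a))
      ≡⟨ cellSum-cong la N (λ i j j<λ →
           trans (cellSum-cong la N (λ i′ j′ _ → invAt-diamond nu la S T S≤ T≥1 i j i′ j′ j<λ))
                 (cellSum-+ la N (innerInv nu S (i , j)) (crossInv nu T (i , j)))) ⟩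
    cellSum la N (λ a → cellSum la N (innerInv nu S a) + cellSum la N (crossInv nu T a))
      ≡⟨ cellSum-+ la N _ _ ⟩
    cellSum la N (λ a → cellSum la N (innerInv nu S a)) + crossCount la nu T
      ≡⟨ cong (_+ crossCount la nu T) innerCount ⟩
    inversions nu S + crossCount la nu T ∎
  where
  open ≡-Reasoning
  Lν : ℕ
  Lν = length (parts nu)
  Lλ : ℕ
  Lλ = length (parts la)
  N : ℕ
  N = Lλ + Lν
  innerCount : cellSum la N (λ a → cellSum la N (innerInv nu S a)) ≡ inversions nu S
  innerCount = begin
      cellSum la N (λ a → cellSum la N (innerInv nu S a))
        ≡⟨ cellSum-cong la N (λ i j _ →
             trans (cellSum-guard la N (inShape? nu (i , j)) (λ b → guard (inShape? nu b) (invAt S (i , j) b)))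
                   (cong (guard (inShape? nu (i , j))) (cellSum-restrict nu la nu⊆la N (invAt S (i , j))))) ⟩
      cellSum la N (λ a → guard (inShape? nu a) (cellSum nu N (invAt S a)))
        ≡⟨ cellSum-restrict nu la nu⊆la N (λ a → cellSum nu N (invAt S a)) ⟩
      cellSum nu N (λ a → cellSum nu N (invAt S a))
        ≡⟨ cong (λ M → cellSum nu M (λ a → cellSum nu M (invAt S a))) (ℕₚ.+-comm Lλ Lν) ⟩
      cellSum nu (Lν + Lλ) (λ a → cellSum nu (Lν + Lλ) (invAt S a))
        ≡⟨ sym (inversions-cellSum nu S Lλ) ⟩
      inversions nu S ∎

minusOnePow-+ : ∀ x y → minusOnePow (x + y) ≡ minusOnePow x * minusOnePow y
minusOnePow-+ zero    y = sym (ℤₚ.*-identityˡ (minusOnePow y))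
minusOnePow-+ (suc x) y = trans (cong -_ (minusOnePow-+ x y)) (ℤₚ.neg-distribˡ-* (minusOnePow x) (minusOnePow y))

minusOnePow-square : ∀ t → minusOnePow t * minusOnePow t ≡ ℤ.+ 1
minusOnePow-square zero    = refl
minusOnePow-square (suc t) = begin
    - s * - s   ≡⟨ sym (ℤₚ.neg-distribˡ-* s (- s)) ⟩
    - (s * - s) ≡⟨ cong -_ (sym (ℤₚ.neg-distribʳ-* s s)) ⟩
    - - (s * s) ≡⟨ ℤₚ.neg-involutive _ ⟩
    s * s       ≡⟨ minusOnePow-square t ⟩
    ℤ.+ 1       ∎
  where
  open ≡-Reasoning
  s : ℤ
  s = minusOnePow t

sign-diamond : (nu la : Partition) → nu ⊆ₚ la → (S T : Filling) →
  (∀ i j → j < part nu i → S (i , j) ≤ skewSize nu emptyPartition) →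
  (∀ i j → part nu i ≤ j → j < part la i → 1 ≤ T (i , j)) →
  signStraight la (diamond emptyPartition nu S T) ≡ signStraight nu S * minusOnePow (crossCount la nu T)
sign-diamond nu la nu⊆la S T S≤ T≥1 =
  trans (cong minusOnePow (inversions-diamond nu la nu⊆la S T S≤ T≥1)) (minusOnePow-+ (inversions nu S) (crossCount la nu T))

insert-square : (a g t c : ℤ) → t * t ≡ ℤ.+ 1 → a * (g * c) ≡ (a * g) * (t * (t * c))
insert-square a g t c t²≡1 = sym (begin
    (a * g) * (t * (t * c)) ≡⟨ cong ((a * g) *_) (sym (ℤₚ.*-assoc t t c)) ⟩
    (a * g) * ((t * t) * c) ≡⟨ cong (λ z → (a * g) * (z * c)) t²≡1 ⟩
    (a * g) * (ℤ.+ 1 * c)   ≡⟨ cong ((a * g) *_) (ℤₚ.*-identityˡ c) ⟩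
    (a * g) * c             ≡⟨ ℤₚ.*-assoc a g c ⟩
    a * (g * c)             ∎)
  where open ≡-Reasoning

SYT-bounded : {la mu : Partition} {T : Filling} → IsSYT la mu T →
  ∀ i j → part mu i ≤ j → j < part la i → T (i , j) ≤ skewSize la mu
SYT-bounded syt i j μ≤j j<λ = proj₂ (IsSYT.inRange syt (i , j) (μ≤j , j<λ))

SYT-positive : {la mu : Partition} {T : Filling} → IsSYT la mu T →
  ∀ i j → part mu i ≤ j → j < part la i → 1 ≤ T (i , j)
SYT-positive syt i j μ≤j j<λ = proj₁ (IsSYT.inRange syt (i , j) (μ≤j , j<λ))

proposition4p2 : (μ ν λ′ : Partition) → μ ⊆ₚ ν → ν ⊆ₚ λ′ →
    (T₁ T₂ : Filling) → IsSYT ν μ T₁ → IsSYT λ′ ν T₂ →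
    (T₀ : Filling) → IsSYT μ emptyPartition T₀ →
    (T₀′ : Filling) → IsSYT ν emptyPartition T₀′ →
    skewSignVia λ′ μ T₀ (diamond μ ν T₁ T₂)
    ≡ skewSignVia ν μ T₀ T₁ * skewSignVia λ′ ν T₀′ T₂
proposition4p2 μ ν λ′ μ⊆ν ν⊆λ T₁ T₂ T₁-syt T₂-syt T₀ T₀-syt T₀′ T₀′-syt = begin
    sign μ T₀ * sign λ′ (diamond emptyPartition μ T₀ (diamond μ ν T₁ T₂))
      ≡⟨ cong (λ n → sign μ T₀ * minusOnePow n) (inversions-cong λ′ _ _ (diamond-assoc μ ν μ⊆ν T₀ T₁ T₂)) ⟩
    sign μ T₀ * sign λ′ (diamond emptyPartition ν G T₂)
      ≡⟨ cong (sign μ T₀ *_) (sign-diamond ν λ′ ν⊆λ G T₂ G-bounded T₂-positive) ⟩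
    sign μ T₀ * (sign ν G * cross)
      ≡⟨ insert-square (sign μ T₀) (sign ν G) (sign ν T₀′) cross (minusOnePow-square (inversions ν T₀′)) ⟩
    (sign μ T₀ * sign ν G) * (sign ν T₀′ * (sign ν T₀′ * cross))
      ≡⟨ cong (λ z → (sign μ T₀ * sign ν G) * (sign ν T₀′ * z))
              (sym (sign-diamond ν λ′ ν⊆λ T₀′ T₂ (λ i j → SYT-bounded T₀′-syt i j z≤n) T₂-positive)) ⟩
    (sign μ T₀ * sign ν G) * (sign ν T₀′ * sign λ′ (diamond emptyPartition ν T₀′ T₂)) ∎
  where
  open ≡-Reasoning
  sign : Partition → Filling → ℤ
  sign = signStraight
  G : Filling
  G = diamond emptyPartition μ T₀ T₁
  cross : ℤ
  cross = minusOnePow (crossCount λ′ ν T₂)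
  G-bounded : ∀ i j → j < part ν i → G (i , j) ≤ skewSize ν emptyPartition
  G-bounded = diamond-bounded μ ν μ⊆ν T₀ T₁ (λ i j → SYT-bounded T₀-syt i j z≤n) (SYT-bounded T₁-syt)
  T₂-positive : ∀ i j → part ν i ≤ j → j < part λ′ i → 1 ≤ T₂ (i , j)
  T₂-positive = SYT-positive T₂-syt
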